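{- Fix $0<\alpha<1$. Let $G$ be a graph without isolated vertices, $B$ a $\wedge_{d,\alpha}$-FBDD representing $\varphi(G)$, $P$ a mainstream path of $B$, and $U_0,U_1\subseteq V(G)\setminus Var(P)$ such that $(Var(P),U_0,U_1)$ is a target triple. For $u\in U_0$ let $I_u=N(u)\cap Var(P)$ if $\mathbf a(P)$ assigns $1$ to every vertex of $N(u)\cap Var(P)$, and $I_u=\{u\}$ otherwise; let $I(P,U_0,U_1)=\bigcup_{u\in U_0}I_u$. Assume $\mathbf a(P)$ can be extended to a satisfying assignment of $\varphi(G)$, and let $\mathbf g$ be a satisfying assignment of $\varphi(G)$ carried through $u(P)$. Then $\mathbf g$ assigns $1$ to every element of $I(P,U_0,U_1)$.
   Context: $\varphi(G)$ is the CNF over $V(G)$ with clauses $(u\vee v)$ for $\{u,v\}\in E(G)$. A $\wedge_d$-FBDD is a DAG with one source, at most two sinks ($True$/$False$), non-sink nodes with two children labelled by a variable (out-edges labelled $0$,$1$) or by $\wedge$, read-once (no directed path repeats a variable) and decomposable (children $u_1,u_2$ of a $\wedge$-node have disjoint $Var(B_{u_1}),Var(B_{u_2})$, $B_u$ being the sub-DAG reachable from $u$). Semantics: $\mathcal S(B)=\{\emptyset\}$/$\emptyset$ at $True$/$False$ sinks; at a variable source $x$ with $0$-child $u_0$, $1$-child $u_1$: $\{(x,0)\}\times\mathcal S(B_{u_0})\times\{0,1\}^{Var(B_{u_1})\setminus Var(B_{u_0})}\cup\{(x,1)\}\times\mathcal S(B_{u_1})\times\{0,1\}^{Var(B_{u_0})\setminus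 Var(B_{u_1})}$; at a $\wedge$ source: $\mathcal S(B_{u_0})\times\mathcal S(B_{u_1})$; $B$ represents the function with satisfying assignments $\mathcal S(B)$. With $n=|Var(B)|$, $u$ small iff $|Var(B_u)|\le n^\alpha$; $\wedge_{d,\alpha}$-FBDD: every $\wedge$-node has a small child. Target path $P$: directed path from the source; $u(P)$ last node; $Var(P)$ variables labelling nodes of $P$ other than $u(P)$; $\mathbf a(P)$ maps each such $x$ to the label of the $P$-edge leaving its node. $P$ mainstream: for every $\wedge$-node of $P$ other than $u(P)$, its child off $P$ is small. An assignment $\mathbf g$ of $Var(B)$ is carried through node $u$ if some target path $P'$ with $u(P')=u$ has $\mathbf a(P')\subseteq\mathbf g$. Target triple in $G$ ($n=|V(G)|$): disjoint $W,U_0,U_1$ with (1) components of $G[U_1]$ of size $>n^\alpha$; (2) each $U_0$-vertex adjacent to $U_1$ and $W$; (3) $U_1$ not adjacent to $W$; (4) $U_0$ independent; (5) $N(U_0)\cap W$ independent; (6) $N(u_1)\cap N(u_2)\cap W=\emptyset$ for distinct $u_1,u_2\in U_0$. -}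

module Defs where

open import Data.Nat using (ℕ; zero; suc; _+_; _*_; _^_; _≤_; _<_)
open import Data.Fin as F using (Fin)
open import Data.Fin.Subset using (Subset; _∈_; ∣_∣)
open import Data.Bool using (Bool; true; false; not)
open import Data.Product using (Σ; ∃; ∃-syntax; _×_; _,_)
open import Data.Sum using (_⊎_)
open import Data.Empty using (⊥)
open import Data.Unit using (⊤)
open import Relation.Nullary using (¬_)
open import Relation.Binary.PropositionalEquality using (_≡_; _≢_)

-- The exponent α ∈ (0,1), given as a real number through its (open)
-- upper Dedekind cut:  Above p q  means  α < p / (1 + q).

record Exponent : Set₁ where
  field
    Above      : ℕ → ℕ → Set
    upClosed   : ∀ {p q p' q'} → Above p q → p * suc q' ≤ p' * suc q → Above p' q'
    rounded    : ∀ {p q} → Above p q → ∃[ p' ] ∃[ q' ] (Above p' q' × p' * suc q < p * suc q')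
    belowOne   : ∃[ p ] ∃[ q ] (Above p q × p < suc q)
    aboveZero  : ∃[ p ] ∃[ q ] (0 < p × ¬ Above p q)

-- k ≤ n ^ α   (for natural k, n):  k ≤ n^r for every rational r > α,
-- i.e. k^(1+q) ≤ n^p whenever α < p/(1+q).
_≤^_[_] : ℕ → ℕ → Exponent → Set
k ≤^ n [ α ] = ∀ p q → Exponent.Above α p q → k ^ suc q ≤ n ^ p

record Graph (N : ℕ) : Set₁ where
  field
    Adj    : Fin N → Fin N → Set
    sym    : ∀ {u v} → Adj u v → Adj v u
    irrefl : ∀ {u} → ¬ Adj u u

module _ {N : ℕ} (G : Graph N) where
  open Graph G

  NoIsolated : Set
  NoIsolated = ∀ v → ∃[ w ] Adj v w

  -- g satisfies φ(G) = ⋀_{uv ∈ E(G)} (u ∨ v)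
  Satisfies : (Fin N → Bool) → Set
  Satisfies g = ∀ u v → Adj u v → g u ≡ true ⊎ g v ≡ true

  data ConnIn (U : Subset N) (x : Fin N) : Fin N → Set where
    here : ConnIn U x x
    step : ∀ {y z} → ConnIn U x y → Adj y z → z ∈ U → ConnIn U x z

  record TargetTriple (α : Exponent) (W : Fin N → Set) (U₀ U₁ : Subset N) : Set where
    field
      disjW₀ : ∀ x → x ∈ U₀ → ¬ W x
      disjW₁ : ∀ x → x ∈ U₁ → ¬ W x
      disj₀₁ : ∀ x → x ∈ U₀ → ¬ x ∈ U₁
      cond1  : ∀ x → x ∈ U₁ → (s : Subset N) →
               (∀ y → ConnIn U₁ x y → y ∈ s) → ¬ (∣ s ∣ ≤^ N [ α ])
      cond2  : ∀ u → u ∈ U₀ → (∃[ v ] (v ∈ U₁ × Adj u v)) × (∃[ w ] (W w × Adj u w))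
      cond3  : ∀ v w → v ∈ U₁ → W w → ¬ Adj v w
      cond4  : ∀ u u' → u ∈ U₀ → u' ∈ U₀ → ¬ Adj u u'
      cond5  : ∀ w w' → W w → W w' → (∃[ u ] (u ∈ U₀ × Adj u w)) →
               (∃[ u' ] (u' ∈ U₀ × Adj u' w')) → ¬ Adj w w'
      cond6  : ∀ u₁ u₂ → u₁ ∈ U₀ → u₂ ∈ U₀ → u₁ ≢ u₂ → ∀ w → W w →
               ¬ (Adj u₁ w × Adj u₂ w)

-- ∧_d-FBDDs over variables Fin N.  Nodes are Fin (suc M), listed in a
-- topological order (every edge goes to a larger index); node zero is
-- the source.

branch : ∀ {A : Set} → Bool → A → A → A
branch false a₀ a₁ = a₀
branch true  a₀ a₁ = a₁

data Label (N M : ℕ) : Set where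
  sink : Bool → Label N M
  dec  : Fin N → Fin M → Fin M → Label N M
  conj : Fin M → Fin M → Label N M

record DAG (N : ℕ) : Set where
  field
    M     : ℕ
    label : Fin (suc M) → Label N (suc M)

  source : Fin (suc M)
  source = F.zero

  data Child (u : Fin (suc M)) : Fin (suc M) → Set where
    decC  : ∀ {x c₀ c₁} → label u ≡ dec x c₀ c₁ → (b : Bool) → Child u (branch b c₀ c₁)
    conjC : ∀ {c₀ c₁}   → label u ≡ conj c₀ c₁  → (b : Bool) → Child u (branch b c₀ c₁)

  data Reach (u : Fin (suc M)) : Fin (suc M) → Set where
    refl : Reach u u
    step : ∀ {v w} → Child u v → Reach v w → Reach u w

  VarLabel : Fin (suc M) → Fin N → Set
  VarLabel v x = ∃[ c₀ ] ∃[ c₁ ] (label v ≡ dec x c₀ c₁)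

  InVar : Fin (suc M) → Fin N → Set
  InVar u x = ∃[ v ] (Reach u v × VarLabel v x)

  -- u is small: |Var(B_u)| ≤ n^α  (here n = |Var(B)| = N)
  Small : Exponent → Fin (suc M) → Set
  Small α u = Σ (Subset N) λ s → (∀ x → InVar u x → x ∈ s) × (∣ s ∣ ≤^ N [ α ])

  -- satisfying assignments, read on total assignments g : Fin N → Bool
  -- (Accepts u g  iff  g restricted to Var(B_u) lies in S(B_u))
  data Accepts (g : Fin N → Bool) : Fin (suc M) → Set where
    accSink : ∀ {u} → label u ≡ sink true → Accepts g u
    accDec  : ∀ {u x c₀ c₁} → label u ≡ dec x c₀ c₁ →
              Accepts g (branch (g x) c₀ c₁) → Accepts g u
    accConj : ∀ {u c₀ c₁} → label u ≡ conj c₀ c₁ →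
              Accepts g c₀ → Accepts g c₁ → Accepts g u

  data Path : Fin (suc M) → Set where
    []    : ∀ {u} → Path u
    decP  : ∀ {u x c₀ c₁} → label u ≡ dec x c₀ c₁ → (b : Bool) →
            Path (branch b c₀ c₁) → Path u
    conjP : ∀ {u c₀ c₁} → label u ≡ conj c₀ c₁ → (b : Bool) →
            Path (branch b c₀ c₁) → Path u

  end : ∀ {u} → Path u → Fin (suc M)
  end {u} []          = u
  end (decP _ _ P)    = end P
  end (conjP _ _ P)   = end P

  InVarP : ∀ {u} → Path u → Fin N → Set
  InVarP []                        y = ⊥
  InVarP (decP {x = x} _ _ P)      y = x ≡ y ⊎ InVarP P y
  InVarP (conjP _ _ P)             y = InVarP P y

  Assigns : ∀ {u} → Path u → Fin N → Bool → Set
  Assigns []                       y c = ⊥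
  Assigns (decP {x = x} _ b P)     y c = (x ≡ y × b ≡ c) ⊎ Assigns P y c
  Assigns (conjP _ _ P)            y c = Assigns P y c

  _⊑_ : ∀ {u} → Path u → (Fin N → Bool) → Set
  P ⊑ g = ∀ y c → Assigns P y c → g y ≡ c

  Mainstream : Exponent → ∀ {u} → Path u → Set
  Mainstream α []                              = ⊤
  Mainstream α (decP _ _ P)                    = Mainstream α P
  Mainstream α (conjP {c₀ = c₀} {c₁} _ b P)    = Small α (branch (not b) c₀ c₁) × Mainstream α P

  CarriedThrough : (Fin N → Bool) → Fin (suc M) → Set
  CarriedThrough g v = Σ (Path source) λ P′ → end P′ ≡ v × P′ ⊑ g

record IsAndFBDD (α : Exponent) {N : ℕ} (B : DAG N) : Set where
  open DAG B
  field
    topo         : ∀ {u v} → Child u v → u F.< v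
    singleSource : ∀ v → Reach source v
    sinks        : ∀ {u v b} → label u ≡ sink b → label v ≡ sink b → u ≡ v
    readOnce     : ∀ {u w v x} → VarLabel u x → Child u w → Reach w v → ¬ VarLabel v x
    decomposable : ∀ {u c₀ c₁} → label u ≡ conj c₀ c₁ → ∀ x → InVar c₀ x → ¬ InVar c₁ x
    andSmall     : ∀ {u c₀ c₁} → label u ≡ conj c₀ c₁ → Small α c₀ ⊎ Small α c₁

Represents : ∀ {N} → Graph N → DAG N → Set
Represents G B = (∀ x → InVar source x) ×
                 (∀ g → Accepts g source → Satisfies G g) ×
                 (∀ g → Satisfies G g → Accepts g source)
  where open DAG B

module _ {N : ℕ} (G : Graph N) (B : DAG N) where
  open Graph G
  open DAG B

  AllOnes : ∀ {u} → Path u → Fin N → Set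
  AllOnes P v = ∀ w → Adj v w → InVarP P w → Assigns P w true

  InI : ∀ {u} → Path u → Subset N → Subset N → Fin N → Set
  InI P U₀ U₁ x = ∃[ v ] (v ∈ U₀ ×
                   ((AllOnes P v × Adj v x × InVarP P x) ⊎ (¬ AllOnes P v × x ≡ v)))

module Submission where

-- Call k patchable at a node s if every assignment accepted by B_s that agrees with k
-- outside Var(B_s) satisfies φ(G). A model of φ(G) is patchable at the source, and by
-- read-once-ness and decomposability this survives along any target path consistent with it;
-- so it holds at u(P) for g and for every model extending a(P).
-- The test models are probes: a(P), extended by 1 and lowered to 0 at one vertex z.
-- Walking down P, all of U₁ stays below the current node: at a decision node a U₁-vertex
-- dropping out would be isolated in G[U₁], and at a ∧-node U₁-vertices in different
-- children are never adjacent, so a component would fit into the small off-path child.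
-- At u(P), splicing a model that is 0 at u ∈ U₀ (g, or the probe at u) inside Var(B_{u(P)})
-- into a patchable one forces 1 on u's neighbours outside; with the U₁-neighbour of u
-- inside Var(B_{u(P)}), this yields g = 1 on I_u.

open import Defs
open import Data.Nat using (ℕ; suc)
open import Data.Nat.Properties using (^-zeroˡ; m^n>0)
open import Data.Fin as F using (Fin)
open import Data.Fin.Properties using (_≟_; any?)
open import Data.Fin.Induction using (>-wellFounded)
open import Data.Fin.Subset using (Subset; _∈_; ⁅_⁆; ∣_∣)
open import Data.Fin.Subset.Properties using (x∈⁅x⁆; ∣⁅x⁆∣≡1)
open import Data.Vec.Functional using (updateAt)
open import Data.Vec.Functional.Properties using (updateAt-updates; updateAt-minimal)
open import Induction.WellFounded using (Acc; acc)
open import Data.Bool using (Bool; true; false; not; if_then_else_)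
open import Data.Bool.Properties using (¬-not; not-¬)
open import Data.Product using (∃-syntax; _×_; _,_; proj₁; proj₂)
open import Data.Sum using (_⊎_; inj₁; inj₂; [_,_])
import Data.Sum as Sum
open import Data.Empty using (⊥-elim)
open import Function using (_∘_; const)
open import Relation.Nullary using (¬_; Dec; yes; no; does; contradiction)
open import Relation.Nullary.Decidable using (_×-dec_; _⊎-dec_; map′; dec-true; dec-false)
open import Relation.Binary.PropositionalEquality using (_≡_; _≢_; refl; sym; trans; subst)

splice : ∀ {n} {S : Fin n → Set} → (∀ t → Dec (S t)) → (Fin n → Bool) → (Fin n → Bool) → Fin n → Bool
splice S? a b t = if does (S? t) then a t else b t

splice-in : ∀ {n} {S : Fin n → Set} (S? : ∀ t → Dec (S t)) a b {t} → S t → splice S? a b t ≡ a t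
splice-in S? _ _ {t} t∈S rewrite dec-true (S? t) t∈S = refl

splice-out : ∀ {n} {S : Fin n → Set} (S? : ∀ t → Dec (S t)) a b {t} → ¬ S t → splice S? a b t ≡ b t
splice-out S? _ _ {t} t∉S rewrite dec-false (S? t) t∉S = refl

branch-cases : ∀ (b b′ : Bool) {A : Set} {a₀ a₁ : A} →
               branch b′ a₀ a₁ ≡ branch b a₀ a₁ ⊎ branch b′ a₀ a₁ ≡ branch (not b) a₀ a₁
branch-cases false false = inj₁ refl
branch-cases false true  = inj₂ refl
branch-cases true  false = inj₂ refl
branch-cases true  true  = inj₁ refl

singleton-≤^ : ∀ {N} (α : Exponent) (x : Fin N) → ∣ ⁅ x ⁆ ∣ ≤^ N [ α ]
singleton-≤^ {suc N} α x p q _ rewrite ∣⁅x⁆∣≡1 x | ^-zeroˡ (suc q) = m^n>0 (suc N) p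

module GraphProperties {N : ℕ} (G : Graph N) where
  open Graph G using (Adj)

  satisfied-at : ∀ {k y w} → Satisfies G k → Adj y w → k y ≡ false → k w ≡ true
  satisfied-at {k} {y} {w} sat yw ky with sat y w yw
  ... | inj₁ ky′ = contradiction (trans (sym ky) ky′) λ ()
  ... | inj₂ kw = kw

  ConnIn-⊆ : ∀ {U x y} → x ∈ U → ConnIn G U x y → y ∈ U
  ConnIn-⊆ x∈U here = x∈U
  ConnIn-⊆ x∈U (step _ _ y∈U) = y∈U

  ConnIn-closed : ∀ {U x} (S : Fin N → Set) →
                  (∀ {y w} → y ∈ U → S y → Adj y w → w ∈ U → S w) →
                  x ∈ U → S x → ∀ {y} → ConnIn G U x y → S y
  ConnIn-closed S closed x∈U Sx here = Sx
  ConnIn-closed S closed x∈U Sx (step c yw w∈U) =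
    closed (ConnIn-⊆ x∈U c) (ConnIn-closed S closed x∈U Sx c) yw w∈U

module DAGProperties {N : ℕ} (B : DAG N) where
  open DAG B

  data Inner (u c₀ c₁ : Fin (suc M)) : Set where
    decI  : ∀ {x} → label u ≡ dec x c₀ c₁ → Inner u c₀ c₁
    conjI : label u ≡ conj c₀ c₁ → Inner u c₀ c₁

  inner-child : ∀ {u c₀ c₁} → Inner u c₀ c₁ → ∀ b → Child u (branch b c₀ c₁)
  inner-child (decI e)  = decC e
  inner-child (conjI e) = conjC e

  inner-children : ∀ {u c₀ c₁ w} → Inner u c₀ c₁ → Child u w → ∃[ b ] w ≡ branch b c₀ c₁
  inner-children (decI e) (decC e′ b) with trans (sym e) e′
  ... | refl = b , refl
  inner-children (decI e) (conjC e′ b) with trans (sym e) e′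
  ... | ()
  inner-children (conjI e) (decC e′ b) with trans (sym e) e′
  ... | ()
  inner-children (conjI e) (conjC e′ b) with trans (sym e) e′
  ... | refl = b , refl

  sink-childless : ∀ {u b w} → label u ≡ sink b → ¬ Child u w
  sink-childless e (decC e′ _) with trans (sym e) e′
  ... | ()
  sink-childless e (conjC e′ _) with trans (sym e) e′
  ... | ()

  reach-trans : ∀ {u v w} → Reach u v → Reach v w → Reach u w
  reach-trans refl r′ = r′
  reach-trans (step c r) r′ = step c (reach-trans r r′)

  reach-end : ∀ {s} (Q : Path s) → Reach s (end Q)
  reach-end []            = refl
  reach-end (decP e b Q)  = step (decC e b) (reach-end Q)
  reach-end (conjP e b Q) = step (conjC e b) (reach-end Q)

  reach-inner : ∀ {u v c₀ c₁} → Inner u c₀ c₁ → Reach u v → u ≡ v ⊎ Reach c₀ v ⊎ Reach c₁ v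
  reach-inner i refl = inj₁ refl
  reach-inner i (step ch r) with inner-children i ch
  ... | false , refl = inj₂ (inj₁ r)
  ... | true  , refl = inj₂ (inj₂ r)

  invar-reach : ∀ {u c x} → Reach u c → InVar c x → InVar u x
  invar-reach r (w , r′ , vl) = w , reach-trans r r′ , vl

  invar-child : ∀ {u c x} → Child u c → InVar c x → InVar u x
  invar-child ch = invar-reach (step ch refl)

  invar-conj : ∀ {s c₀ c₁ x} → label s ≡ conj c₀ c₁ → ∀ b → InVar s x →
               InVar (branch b c₀ c₁) x ⊎ InVar (branch (not b) c₀ c₁) x
  invar-conj e b (_ , refl , _ , _ , e′) with trans (sym e) e′
  ... | ()
  invar-conj e b (w , step ch r , vl) with inner-children (conjI e) ch
  ... | b′ , refl =
    Sum.map (λ eq → subst (λ c → InVar c _) eq (w , r , vl))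
            (λ eq → subst (λ c → InVar c _) eq (w , r , vl)) (branch-cases b b′)

  varLabel? : ∀ v x → Dec (VarLabel v x)
  varLabel? v x with label v
  ... | sink _     = no λ { (_ , _ , ()) }
  ... | conj _ _   = no λ { (_ , _ , ()) }
  ... | dec y c₀ c₁ = map′ (λ { refl → c₀ , c₁ , refl }) (λ { (_ , _ , refl) → refl }) (y ≟ x)

  invarP? : ∀ {s} (Q : Path s) y → Dec (InVarP Q y)
  invarP? []                   y = no λ ()
  invarP? (decP {x = x} _ _ Q) y = (x ≟ y) ⊎-dec invarP? Q y
  invarP? (conjP _ _ Q)        y = invarP? Q y

  assigns-invarP : ∀ {s} (Q : Path s) {y c} → Assigns Q y c → InVarP Q y
  assigns-invarP (decP e b Q)  (inj₁ (x≡y , _)) = inj₁ x≡y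
  assigns-invarP (decP e b Q)  (inj₂ a)         = inj₂ (assigns-invarP Q a)
  assigns-invarP (conjP e b Q) a                = assigns-invarP Q a

  assigns-value : ∀ {s k} (Q : Path s) → Q ⊑ k → ∀ {y} → InVarP Q y → Assigns Q y (k y)
  assigns-value (decP {x = x} e b Q) Q⊑k (inj₁ refl) = inj₁ (refl , sym (Q⊑k x b (inj₁ (refl , refl))))
  assigns-value (decP e b Q) Q⊑k (inj₂ y∈Q) = inj₂ (assigns-value Q (λ y c → Q⊑k y c ∘ inj₂) y∈Q)
  assigns-value (conjP e b Q) Q⊑k y∈Q = assigns-value Q Q⊑k y∈Q

  accepts-dec : ∀ {k u x c₀ c₁} → label u ≡ dec x c₀ c₁ → Accepts k u → Accepts k (branch (k x) c₀ c₁)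
  accepts-dec e (accSink e′) with trans (sym e) e′
  ... | ()
  accepts-dec e (accDec e′ a) with trans (sym e) e′
  ... | refl = a
  accepts-dec e (accConj e′ _ _) with trans (sym e) e′
  ... | ()

  accepts-conj : ∀ {k u c₀ c₁} → label u ≡ conj c₀ c₁ → Accepts k u → ∀ b → Accepts k (branch b c₀ c₁)
  accepts-conj e (accSink e′) b with trans (sym e) e′
  ... | ()
  accepts-conj e (accDec e′ _) b with trans (sym e) e′
  ... | ()
  accepts-conj e (accConj e′ a₀ a₁) false with trans (sym e) e′
  ... | refl = a₀
  accepts-conj e (accConj e′ a₀ a₁) true with trans (sym e) e′
  ... | refl = a₁

  conj-accepts : ∀ {k u c₀ c₁} → label u ≡ conj c₀ c₁ → ∀ b →
                 Accepts k (branch b c₀ c₁) → Accepts k (branch (not b) c₀ c₁) → Accepts k u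
  conj-accepts e false a a′ = accConj e a a′
  conj-accepts e true  a a′ = accConj e a′ a

  accepts-local : ∀ {k k′ u} → (∀ x → InVar u x → k x ≡ k′ x) → Accepts k u → Accepts k′ u
  accepts-local agree (accSink e) = accSink e
  accepts-local {k} {k′} {u} agree (accDec {x = x} {c₀} {c₁} e a) =
    accDec e (subst (λ b → Accepts k′ (branch b c₀ c₁)) (agree x (u , refl , c₀ , c₁ , e))
                    (accepts-local (λ y → agree y ∘ invar-child (decC e (k x))) a))
  accepts-local agree (accConj e a₀ a₁) =
    accConj e (accepts-local (λ y → agree y ∘ invar-child (conjC e false)) a₀)
              (accepts-local (λ y → agree y ∘ invar-child (conjC e true)) a₁)

  reach-via : ∀ {u v c₀ c₁} → Inner u c₀ c₁ → Dec (Reach c₀ v) → Dec (Reach c₁ v) → Dec (Reach u v)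
  reach-via {u} {v} i r₀? r₁? =
    map′ [ (λ { refl → refl }) , [ step (inner-child i false) , step (inner-child i true) ] ]
         (reach-inner i) ((u ≟ v) ⊎-dec r₀? ⊎-dec r₁?)

  module Acyclic (topo : ∀ {u v} → Child u v → u F.< v) where

    reach? : ∀ u → Acc F._>_ u → ∀ v → Dec (Reach u v)
    reach? u (acc rs) v with label u in eq
    ... | sink _ = map′ (λ { refl → refl })
                        (λ { refl → refl ; (step ch _) → contradiction ch (sink-childless eq) })
                        (u ≟ v)
    ... | dec _ c₀ c₁ = reach-via (decI eq) (reach? c₀ (rs (topo (decC eq false))) v)
                                            (reach? c₁ (rs (topo (decC eq true))) v)
    ... | conj c₀ c₁ = reach-via (conjI eq) (reach? c₀ (rs (topo (conjC eq false))) v)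
                                            (reach? c₁ (rs (topo (conjC eq true))) v)

    invar? : ∀ u x → Dec (InVar u x)
    invar? u x = any? λ w → reach? u (>-wellFounded u) w ×-dec varLabel? w x

module Patching {α : Exponent} {N : ℕ} {G : Graph N} {B : DAG N} (fb : IsAndFBDD α B) where
  open DAG B
  open DAGProperties B
  open IsAndFBDD fb
  open Acyclic topo public
  open Graph G using (Adj)
  open GraphProperties G

  dec-fresh : ∀ {s x c₀ c₁} → label s ≡ dec x c₀ c₁ → ∀ b → ¬ InVar (branch b c₀ c₁) x
  dec-fresh e b (_ , r , vl) = readOnce (_ , _ , e) (decC e b) r vl

  conj-disjoint : ∀ {s c₀ c₁} → label s ≡ conj c₀ c₁ → ∀ b {x} →
                  InVar (branch (not b) c₀ c₁) x → ¬ InVar (branch b c₀ c₁) x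
  conj-disjoint e false off on = decomposable e _ on off
  conj-disjoint e true  off on = decomposable e _ off on

  path-fresh : ∀ {s} (Q : Path s) {y} → InVarP Q y → ¬ InVar (end Q) y
  path-fresh (decP e b Q) (inj₁ refl) = dec-fresh e b ∘ invar-reach (reach-end Q)
  path-fresh (decP e b Q) (inj₂ y∈Q)  = path-fresh Q y∈Q
  path-fresh (conjP e b Q) y∈Q        = path-fresh Q y∈Q

  Patchable : Fin (suc M) → (Fin N → Bool) → Set
  Patchable s k = Accepts k s ×
                  (∀ k′ → (∀ x → ¬ InVar s x → k′ x ≡ k x) → Accepts k′ s → Satisfies G k′)

  patchable-source : Represents G B → ∀ {k} → Satisfies G k → Patchable source k
  patchable-source (_ , sound , complete) sat = complete _ sat , λ k′ _ → sound k′

  patchable-dec : ∀ {s x c₀ c₁ k b} → label s ≡ dec x c₀ c₁ → k x ≡ b →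
                  Patchable s k → Patchable (branch b c₀ c₁) k
  patchable-dec {x = x} {c₀} {c₁} {k} {b} e kx≡b (acc-k , patch) =
    subst (λ b → Accepts k (branch b c₀ c₁)) kx≡b (accepts-dec e acc-k) ,
    λ k′ agree acc-k′ → patch k′ (λ y → agree y ∘ (_∘ invar-child (decC e b)))
      (accDec e (subst (λ b → Accepts k′ (branch b c₀ c₁))
                       (sym (trans (agree x (dec-fresh e b)) kx≡b)) acc-k′))

  patchable-conj : ∀ {s c₀ c₁ k} → label s ≡ conj c₀ c₁ → ∀ b →
                   Patchable s k → Patchable (branch b c₀ c₁) k
  patchable-conj e b (acc-k , patch) =
    accepts-conj e acc-k b ,
    λ k′ agree acc-k′ → patch k′ (λ y → agree y ∘ (_∘ invar-child (conjC e b)))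
      (conj-accepts e b acc-k′
        (accepts-local (λ y y∈off → sym (agree y (conj-disjoint e b y∈off)))
                       (accepts-conj e acc-k (not b))))

  patchable-end : ∀ {s k} (Q : Path s) → Q ⊑ k → Patchable s k → Patchable (end Q) k
  patchable-end []            _   p = p
  patchable-end (decP e b Q)  Q⊑k p =
    patchable-end Q (λ y c → Q⊑k y c ∘ inj₂) (patchable-dec e (Q⊑k _ b (inj₁ (refl , refl))) p)
  patchable-end (conjP e b Q) Q⊑k p = patchable-end Q Q⊑k (patchable-conj e b p)

  mix : Fin (suc M) → (Fin N → Bool) → (Fin N → Bool) → Fin N → Bool
  mix s = splice (invar? s)

  mix-satisfies : ∀ {s a b} → Patchable s b → Accepts a s → Satisfies G (mix s a b)
  mix-satisfies {s} {a} {b} (_ , patch) acc-a =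
    patch _ (λ x → splice-out (invar? s) a b) (accepts-local (λ x → sym ∘ splice-in (invar? s) a b) acc-a)

  mix-forces : ∀ {s a b y w} → Patchable s b → Accepts a s → Adj y w →
               InVar s y → a y ≡ false → ¬ InVar s w → b w ≡ true
  mix-forces {s} {a} {b} p acc-a yw y∈s ay w∉s =
    trans (sym (splice-out (invar? s) a b w∉s))
          (satisfied-at (mix-satisfies p acc-a) yw (trans (splice-in (invar? s) a b y∈s) ay))

module TargetTripleOnPath
  (α : Exponent) {N : ℕ} (G : Graph N) (B : DAG N) (fb : IsAndFBDD α B) (rep : Represents G B)
  (P : DAG.Path B (DAG.source B)) (U₀ U₁ : Subset N)
  (U₁∉P : ∀ x → x ∈ U₁ → ¬ DAG.InVarP B P x)
  (tt : TargetTriple G α (DAG.InVarP B P) U₀ U₁)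
  (h : Fin N → Bool) (h-sat : Satisfies G h) (P⊑h : DAG._⊑_ B P h) where

  open Graph G using (Adj; irrefl) renaming (sym to Adj-sym)
  open GraphProperties G
  open DAG B
  open DAGProperties B
  open Patching {G = G} fb
  open TargetTriple tt

  probe : Fin N → Fin N → Bool
  probe z = updateAt (splice (invarP? P) h (const true)) z (const false)

  probe-at : ∀ z → probe z z ≡ false
  probe-at z = updateAt-updates z _

  probe-on : ∀ {z t} → t ≢ z → InVarP P t → probe z t ≡ h t
  probe-on {z} {t} t≢z t∈P = trans (updateAt-minimal t z _ t≢z) (splice-in (invarP? P) h _ t∈P)

  probe-true : ∀ {z t} → t ≢ z → (InVarP P t → h t ≡ true) → probe z t ≡ true
  probe-true {z} {t} t≢z ht with invarP? P t
  ... | yes t∈P = trans (probe-on t≢z t∈P) (ht t∈P)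
  ... | no t∉P  = trans (updateAt-minimal t z _ t≢z) (splice-out (invarP? P) h _ t∉P)

  probe-satisfies : ∀ {z} → (∀ w → Adj z w → InVarP P w → h w ≡ true) → Satisfies G (probe z)
  probe-satisfies {z} N⊆1 a b ab with a ≟ z | b ≟ z
  ... | yes refl | yes refl = contradiction ab irrefl
  ... | yes refl | no b≢z   = inj₂ (probe-true b≢z (N⊆1 b ab))
  ... | no a≢z   | yes refl = inj₁ (probe-true a≢z (N⊆1 a (Adj-sym ab)))
  ... | no a≢z   | no b≢z   =
    Sum.map (probe-true a≢z ∘ const) (probe-true b≢z ∘ const) (h-sat a b ab)

  probe-extends : ∀ {z} → ¬ InVarP P z → P ⊑ probe z
  probe-extends z∉P y c a =
    let y∈P = assigns-invarP P a in
    trans (probe-on (λ { refl → z∉P y∈P }) y∈P) (P⊑h y c a)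

  patchable-end-P : ∀ {k} → Satisfies G k → P ⊑ k → Patchable (end P) k
  patchable-end-P sat P⊑k = patchable-end P P⊑k (patchable-source rep sat)

  probe-U₁-sat : ∀ {z} → z ∈ U₁ → Satisfies G (probe z)
  probe-U₁-sat z∈U₁ = probe-satisfies (λ w zw w∈P → ⊥-elim (cond3 _ w z∈U₁ w∈P zw))

  closed-not-small : ∀ {z} → z ∈ U₁ → (S : Fin N → Set) → S z →
                     (∀ {y w} → y ∈ U₁ → S y → Adj y w → w ∈ U₁ → S w) →
                     (s : Subset N) → (∀ y → S y → y ∈ s) → ¬ (∣ s ∣ ≤^ N [ α ])
  closed-not-small z∈U₁ S Sz closed s S⊆s =
    cond1 _ z∈U₁ s (λ y → S⊆s y ∘ ConnIn-closed S closed z∈U₁ Sz)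

  U₁⊆Var : Fin (suc M) → Set
  U₁⊆Var s = ∀ z → z ∈ U₁ → InVar s z

  U₁-dec-step : ∀ {s x c₀ c₁ b} → label s ≡ dec x c₀ c₁ → ¬ x ∈ U₁ →
                (∀ z → z ∈ U₁ → probe z x ≡ b × Patchable s (probe z)) →
                U₁⊆Var s → U₁⊆Var (branch b c₀ c₁)
  U₁-dec-step {s} {x} {c₀} {c₁} {b} e x∉U₁ probes U₁⊆s z z∈U₁ with invar? (branch b c₀ c₁) z
  ... | yes z∈c = z∈c
  ... | no  z∉c = ⊥-elim (closed-not-small z∈U₁ (_≡ z) refl (λ { _ refl zw w∈U₁ → ⊥-elim (isolated w∈U₁ zw) })
                                            ⁅ z ⁆ (λ { _ refl → x∈⁅x⁆ z }) (singleton-≤^ α z))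
    where
    -- z is in Var(B_s) but not below the decision on x, so lowering z alone in the probe of a
    -- U₁-neighbour w keeps it accepted at s, yet falsifies the clause (z ∨ w).
    isolated : ∀ {w} → w ∈ U₁ → ¬ Adj z w
    isolated {w} w∈U₁ zw = not-¬ kw≡false (satisfied-at k-sat zw (updateAt-updates z _))
      where
      k : Fin N → Bool
      k = updateAt (probe w) z (const false)
      k-elsewhere : ∀ {t} → t ≢ z → k t ≡ probe w t
      k-elsewhere {t} = updateAt-minimal t z (probe w)
      kw≡false : k w ≡ false
      kw≡false = trans (k-elsewhere λ { refl → irrefl zw }) (probe-at w)
      kx≡b : k x ≡ b
      kx≡b = trans (k-elsewhere λ { refl → x∉U₁ z∈U₁ }) (proj₁ (probes w w∈U₁))
      accepts-c : Accepts k (branch b c₀ c₁)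
      accepts-c = accepts-local (λ t t∈c → sym (k-elsewhere λ { refl → z∉c t∈c }))
                                (proj₁ (patchable-dec e (proj₁ (probes w w∈U₁)) (proj₂ (probes w w∈U₁))))
      k-sat : Satisfies G k
      k-sat = proj₂ (proj₂ (probes w w∈U₁)) k (λ t t∉s → k-elsewhere λ { refl → t∉s (U₁⊆s z z∈U₁) })
                (accDec e (subst (λ b → Accepts k (branch b c₀ c₁)) (sym kx≡b) accepts-c))

  U₁-conj-step : ∀ {s c₀ c₁} → label s ≡ conj c₀ c₁ → ∀ b → Small α (branch (not b) c₀ c₁) →
                 (∀ z → z ∈ U₁ → Patchable s (probe z)) → U₁⊆Var s → U₁⊆Var (branch b c₀ c₁)
  U₁-conj-step {s} {c₀} {c₁} e b (bound , off⊆bound , small) probes U₁⊆s z z∈U₁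
    with invar-conj e b (U₁⊆s z z∈U₁)
  ... | inj₁ z∈on  = z∈on
  ... | inj₂ z∈off = ⊥-elim (closed-not-small z∈U₁ (InVar (branch (not b) c₀ c₁)) z∈off closed
                                              bound off⊆bound small)
    where
    -- A U₁-edge across the ∧-node would be falsified by splicing two probes.
    closed : ∀ {y w} → y ∈ U₁ → InVar (branch (not b) c₀ c₁) y → Adj y w → w ∈ U₁ →
             InVar (branch (not b) c₀ c₁) w
    closed {y} {w} y∈U₁ y∈off yw w∈U₁ with invar-conj e b (U₁⊆s w w∈U₁)
    ... | inj₂ w∈off = w∈off
    ... | inj₁ w∈on  =
      contradiction (mix-forces (patchable-conj e b (probes y y∈U₁)) (proj₁ (patchable-conj e b (probes w w∈U₁)))
                                (Adj-sym yw) w∈on (probe-at w) (conj-disjoint e b y∈off))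
                    (not-¬ (probe-at y))

  Tracked : ∀ {s} → Path s → Set
  Tracked {s} Q = ∀ z → z ∈ U₁ → ¬ InVarP Q z × Q ⊑ probe z × Patchable s (probe z)

  U₁⊆end : ∀ {s} (Q : Path s) → Mainstream α Q → Tracked Q → U₁⊆Var s → U₁⊆Var (end Q)
  U₁⊆end [] _ _ U₁⊆s = U₁⊆s
  U₁⊆end (decP e b Q) ms tracked U₁⊆s =
    U₁⊆end Q ms tracked-Q
      (U₁-dec-step e (λ x∈U₁ → proj₁ (tracked _ x∈U₁) (inj₁ refl))
                   (λ z z∈U₁ → b-at-x z z∈U₁ , proj₂ (proj₂ (tracked z z∈U₁))) U₁⊆s)
    where
    b-at-x : ∀ z → z ∈ U₁ → probe z _ ≡ b
    b-at-x z z∈U₁ = proj₁ (proj₂ (tracked z z∈U₁)) _ b (inj₁ (refl , refl))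
    tracked-Q : Tracked Q
    tracked-Q z z∈U₁ = let (z∉ , ⊑z , p) = tracked z z∈U₁ in
      z∉ ∘ inj₂ , (λ y c → ⊑z y c ∘ inj₂) , patchable-dec e (b-at-x z z∈U₁) p
  U₁⊆end (conjP e b Q) (small , ms) tracked U₁⊆s =
    U₁⊆end Q ms (λ z z∈U₁ → let (z∉ , ⊑z , p) = tracked z z∈U₁ in z∉ , ⊑z , patchable-conj e b p)
      (U₁-conj-step e b small (λ z → proj₂ ∘ proj₂ ∘ tracked z) U₁⊆s)

  U₁⊆end-P : Mainstream α P → U₁⊆Var (end P)
  U₁⊆end-P ms = U₁⊆end P ms tracked (λ z _ → proj₁ rep z)
    where
    tracked : Tracked P
    tracked z z∈U₁ = U₁∉P z z∈U₁ , probe-extends (U₁∉P z z∈U₁) , patchable-source rep (probe-U₁-sat z∈U₁)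

  patchable-carried : ∀ {g} → Satisfies G g → CarriedThrough g (end P) → Patchable (end P) g
  patchable-carried {g} sat (P′ , P′-end , P′⊑g) =
    subst (λ v → Patchable v g) P′-end (patchable-end P′ P′⊑g (patchable-source rep sat))

  module _ (ms : Mainstream α P) where

    true-off-end : ∀ {a u y} → Patchable (end P) a → y ∈ U₁ → Adj u y → ¬ InVar (end P) u → a u ≡ true
    true-off-end a-patchable y∈U₁ uy u∉end =
      mix-forces a-patchable (proj₁ (patchable-end-P (probe-U₁-sat y∈U₁) (probe-extends (U₁∉P _ y∈U₁))))
                 (Adj-sym uy) (U₁⊆end-P ms _ y∈U₁) (probe-at _) u∉end

    all-ones-case : ∀ {g u} → Patchable (end P) g → u ∈ U₀ → AllOnes G B P u →
                    ∀ x → Adj u x → InVarP P x → g x ≡ true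
    all-ones-case {g} {u} g-patchable u∈U₀ all-ones x ux x∈P =
      mix-forces g-patchable (proj₁ probe-u-patchable) ux u∈end (probe-at u) (path-fresh P x∈P)
      where
      probe-u-patchable : Patchable (end P) (probe u)
      probe-u-patchable = patchable-end-P (probe-satisfies λ w uw w∈P → P⊑h w true (all-ones w uw w∈P))
                                          (probe-extends (disjW₀ u u∈U₀))
      u∈end : InVar (end P) u
      u∈end with invar? (end P) u | proj₁ (cond2 u u∈U₀)
      ... | yes u∈end | _ = u∈end
      ... | no  u∉end | _ , y∈U₁ , uy =
        contradiction (true-off-end probe-u-patchable y∈U₁ uy u∉end) (not-¬ (probe-at u))

    not-all-ones-case : ∀ {g u} → Patchable (end P) g → u ∈ U₀ → ¬ AllOnes G B P u → g u ≡ true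
    not-all-ones-case {g} {u} g-patchable u∈U₀ not-all-ones with invar? (end P) u | proj₁ (cond2 u u∈U₀)
    ... | no  u∉end | _ , y∈U₁ , uy = true-off-end g-patchable y∈U₁ uy u∉end
    ... | yes u∈end | _ = ¬-not λ gu≡false → not-all-ones λ w uw w∈P →
      subst (Assigns P w)
            (mix-forces (patchable-end-P h-sat P⊑h) (proj₁ g-patchable) uw u∈end gu≡false (path-fresh P w∈P))
            (assigns-value P P⊑h w∈P)

lemma8 : (α : Exponent) {N : ℕ} (G : Graph N) → NoIsolated G →
         (B : DAG N) → IsAndFBDD α B → Represents G B →
         (P : DAG.Path B (DAG.source B)) → DAG.Mainstream B α P →
         (U₀ U₁ : Subset N) →
         (∀ x → x ∈ U₀ → ¬ DAG.InVarP B P x) →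
         (∀ x → x ∈ U₁ → ¬ DAG.InVarP B P x) →
         TargetTriple G α (DAG.InVarP B P) U₀ U₁ →
         (∃[ h ] (Satisfies G h × DAG._⊑_ B P h)) →
         (g : Fin N → Bool) → Satisfies G g →
         DAG.CarriedThrough B g (DAG.end B P) →
         ∀ x → InI G B P U₀ U₁ x → g x ≡ true
lemma8 α G _ B fb rep P ms U₀ U₁ _ U₁∉P tt (h , h-sat , P⊑h) g g-sat carried x
       (u , u∈U₀ , inj₁ (all-ones , ux , x∈P)) =
  all-ones-case ms (patchable-carried g-sat carried) u∈U₀ all-ones x ux x∈P
  where open TargetTripleOnPath α G B fb rep P U₀ U₁ U₁∉P tt h h-sat P⊑h
lemma8 α G _ B fb rep P ms U₀ U₁ _ U₁∉P tt (h , h-sat , P⊑h) g g-sat carried x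
       (u , u∈U₀ , inj₂ (not-all-ones , refl)) =
  not-all-ones-case ms (patchable-carried g-sat carried) u∈U₀ not-all-ones
  where open TargetTripleOnPath α G B fb rep P U₀ U₁ U₁∉P tt h h-sat P⊑h
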